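{- Let $A_k=\{a_1,\dots,a_k\}$ with $1=a_1<a_2<\dots<a_k$ integers, let $h_0$ be the smallest positive integer $h$ with $n(h)\ge a_k$, and let $h\ge h_0+1$ be an integer. Let $x$ be an $h$-gap with $x_h=c_{k-1}a_{k-1}+\dots+c_1a_1$, where the $c_i$ are nonnegative integers with $\sum_{i=1}^{k-1}c_i\le h$. Then for every $i\in\{1,\dots,k-1\}$ with $c_i>0$, the integer $x+(a_k-a_i)$ is an $(h-1)$-gap.
   Context: For an integer $h\ge 0$, an integer $y\ge 0$ has an $h$-representation if $y=\sum_{i=1}^k c_ia_i$ with nonnegative integers $c_i$ and $\sum_i c_i\le h$. The $h$-range $n(h)$ is the largest integer $n$ such that every integer $0\le y\le n$ has an $h$-representation. For an integer $x$ and integer $h$, put $x_h=x+(h-(h_0-1))a_k$. For an integer $m\ge h_0$, an integer $x>n(h_0-1)$ is called an $m$-gap if $x_h$ has no $h$-representation for every integer $h$ with $h_0-1\le h<m$, but $x_m$ has an $m$-representation. -}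

module Defs where

open import Data.Nat using (ℕ; zero; suc; _+_; _*_; _∸_; _≤_; _<_)
open import Data.Fin using (Fin; fromℕ)
import Data.Fin as F
open import Data.Product using (Σ; _×_)
open import Relation.Nullary using (¬_)
open import Relation.Binary.PropositionalEquality using (_≡_)

∑ : ∀ {k} → (Fin k → ℕ) → ℕ
∑ {zero}  f = 0
∑ {suc k} f = f F.zero + ∑ (λ i → f (F.suc i))

-- the set A = {a_1,...,a_k} is given as a : Fin k → ℕ (a F.zero = a_1)
-- y has an h-representation: y = Σ c_i a_i with c_i ≥ 0 and Σ c_i ≤ h
HRep : ∀ {k} → (Fin k → ℕ) → ℕ → ℕ → Set
HRep {k} a h y = Σ (Fin k → ℕ) λ c → (∑ c ≤ h) × (∑ (λ i → c i * a i) ≡ y)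

IsRange : ∀ {k} → (Fin k → ℕ) → ℕ → ℕ → Set
IsRange a h n =
  (∀ y → y ≤ n → HRep a h y) ×
  (∀ m → (∀ y → y ≤ m → HRep a h y) → m ≤ n)

top : ∀ {k} → (Fin (suc k) → ℕ) → ℕ
top {k} a = a (fromℕ k)

IsH0 : ∀ {k} → (Fin (suc k) → ℕ) → ℕ → Set
IsH0 a h0 =
  (0 < h0) ×
  (Σ ℕ λ N → IsRange a h0 N × (top a ≤ N)) ×
  (∀ h → 0 < h → h < h0 → ∀ N → IsRange a h N → N < top a)

-- x_h = x + (h - (h0 - 1)) a_k   (only used for h ≥ h0 - 1)
shift : ∀ {k} → (Fin (suc k) → ℕ) → ℕ → ℕ → ℕ → ℕ
shift a h0 x h = x + (h ∸ (h0 ∸ 1)) * top a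

IsGap : ∀ {k} → (Fin (suc k) → ℕ) → ℕ → ℕ → ℕ → Set
IsGap a h0 m x =
  (h0 ≤ m) ×
  (∀ N → IsRange a (h0 ∸ 1) N → N < x) ×
  (∀ h → h0 ∸ 1 ≤ h → h < m → ¬ HRep a h (shift a h0 x h)) ×
  HRep a m (shift a h0 x m)

module Submission where

-- Let x' = x + (a_k - a_i).  The whole proof rests on the identity
--     x'_t + a_i = x_(t+1)        for every t ≥ h0 - 1,
-- i.e. shifting x' one level down and adding one copy of a_i lands on the
-- next shift of x.  With it the four gap conditions for x' follow:
--   * h0 ≤ h - 1 and x' ≥ x > n(h0 - 1) are immediate;
--   * a t-representation of x'_t (h0 - 1 ≤ t < h - 1) plus one extra part a_i
--     would be a (t+1)-representation of x_(t+1), which the gap x forbids;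
--   * removing one part a_i from the given representation of x_h (possible as
--     c_i > 0) leaves an (h-1)-representation of x'_(h-1).

open import Defs
open import Data.Nat using (ℕ; zero; suc; pred; _+_; _*_; _∸_; _≤_; _<_; z≤n; s≤s; s≤s⁻¹; >-nonZero)
open import Data.Nat.Properties
open import Data.Fin using (Fin; inject₁; fromℕ)
import Data.Fin as F
open import Data.Product using (_,_)
open import Relation.Nullary using (¬_)
open import Function using (_∘_)
open import Relation.Binary.PropositionalEquality
open ≡-Reasoning

∑-cong : ∀ {n} {f g : Fin n → ℕ} → (∀ j → f j ≡ g j) → ∑ f ≡ ∑ g
∑-cong {zero}  eq = refl
∑-cong {suc n} eq = cong₂ _+_ (eq F.zero) (∑-cong (eq ∘ F.suc))

bump : ∀ {n} → (Fin n → ℕ) → Fin n → Fin n → ℕ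
bump c F.zero    F.zero    = suc (c F.zero)
bump c F.zero    (F.suc j) = c (F.suc j)
bump c (F.suc i) F.zero    = c F.zero
bump c (F.suc i) (F.suc j) = bump (c ∘ F.suc) i j

unbump : ∀ {n} → (Fin n → ℕ) → Fin n → Fin n → ℕ
unbump c F.zero    F.zero    = pred (c F.zero)
unbump c F.zero    (F.suc j) = c (F.suc j)
unbump c (F.suc i) F.zero    = c F.zero
unbump c (F.suc i) (F.suc j) = unbump (c ∘ F.suc) i j

∑-bump : ∀ {n} (b c : Fin n → ℕ) (i : Fin n) →
  ∑ (λ j → bump c i j * b j) ≡ ∑ (λ j → c j * b j) + b i
∑-bump b c F.zero =
  begin
    (b F.zero + c F.zero * b F.zero) + S
  ≡⟨ cong (_+ S) (+-comm (b F.zero) _) ⟩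
    (c F.zero * b F.zero + b F.zero) + S
  ≡⟨ +-assoc _ (b F.zero) S ⟩
    c F.zero * b F.zero + (b F.zero + S)
  ≡⟨ cong (c F.zero * b F.zero +_) (+-comm (b F.zero) S) ⟩
    c F.zero * b F.zero + (S + b F.zero)
  ≡⟨ +-assoc _ S (b F.zero) ⟨
    (c F.zero * b F.zero + S) + b F.zero
  ∎
  where S = ∑ (λ j → c (F.suc j) * b (F.suc j))
∑-bump b c (F.suc i) =
  trans (cong (c F.zero * b F.zero +_) (∑-bump (b ∘ F.suc) (c ∘ F.suc) i))
        (sym (+-assoc (c F.zero * b F.zero) _ (b (F.suc i))))

bump-unbump : ∀ {n} (c : Fin n → ℕ) (i : Fin n) → 0 < c i →
  ∀ j → bump (unbump c i) i j ≡ c j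
bump-unbump c F.zero    ci>0 F.zero    = suc-pred (c F.zero) {{>-nonZero ci>0}}
bump-unbump c F.zero    ci>0 (F.suc j) = refl
bump-unbump c (F.suc i) ci>0 F.zero    = refl
bump-unbump c (F.suc i) ci>0 (F.suc j) = bump-unbump (c ∘ F.suc) i ci>0 j

∑-bump-count : ∀ {n} (c : Fin n → ℕ) (i : Fin n) → ∑ (bump c i) ≡ suc (∑ c)
∑-bump-count c i =
  begin
    ∑ (bump c i)                          ≡⟨ ∑-cong (λ j → sym (*-identityʳ (bump c i j))) ⟩
    ∑ (λ j → bump c i j * 1)              ≡⟨ ∑-bump (λ _ → 1) c i ⟩
    ∑ (λ j → c j * 1) + 1                 ≡⟨ cong (_+ 1) (∑-cong (λ j → *-identityʳ (c j))) ⟩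
    ∑ c + 1                               ≡⟨ +-comm (∑ c) 1 ⟩
    suc (∑ c)
  ∎

addPart : ∀ {n} {b : Fin n → ℕ} {h y : ℕ} → HRep b h y → (i : Fin n) →
  HRep b (suc h) (y + b i)
addPart {b = b} (c , parts , value) i =
    bump c i
  , subst (_≤ _) (sym (∑-bump-count c i)) (s≤s parts)
  , trans (∑-bump b c i) (cong (_+ b i) value)

removePart : ∀ {n} {b : Fin n → ℕ} {h y : ℕ} (c : Fin n → ℕ) (i : Fin n) →
  ∑ c ≤ suc h → ∑ (λ j → c j * b j) ≡ y + b i → 0 < c i → HRep b h y
removePart {b = b} {h} {y} c i parts value ci>0 =
  unbump c i , s≤s⁻¹ parts′ , +-cancelʳ-≡ (b i) _ _ value′
  where
  restore : ∀ j → bump (unbump c i) i j ≡ c j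
  restore = bump-unbump c i ci>0

  parts′ : suc (∑ (unbump c i)) ≤ suc h
  parts′ = subst (_≤ suc h)
                 (trans (sym (∑-cong restore)) (∑-bump-count (unbump c i) i)) parts

  value′ : ∑ (λ j → unbump c i j * b j) + b i ≡ y + b i
  value′ = begin
    ∑ (λ j → unbump c i j * b j) + b i   ≡⟨ ∑-bump b (unbump c i) i ⟨
    ∑ (λ j → bump (unbump c i) i j * b j) ≡⟨ ∑-cong (λ j → cong (_* b j) (restore j)) ⟩
    ∑ (λ j → c j * b j)                  ≡⟨ value ⟩
    y + b i
    ∎

padTop : ∀ {k} → (Fin k → ℕ) → Fin (suc k) → ℕ
padTop {zero}  c _         = 0
padTop {suc k} c F.zero    = c F.zero
padTop {suc k} c (F.suc j) = padTop (c ∘ F.suc) j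

∑-padTop : ∀ {k} (c : Fin k → ℕ) (b : Fin (suc k) → ℕ) →
  ∑ (λ j → padTop c j * b j) ≡ ∑ (λ j → c j * b (inject₁ j))
∑-padTop {zero}  c b = refl
∑-padTop {suc k} c b = cong (c F.zero * b F.zero +_) (∑-padTop (c ∘ F.suc) (b ∘ F.suc))

∑-padTop-count : ∀ {k} (c : Fin k → ℕ) → ∑ (padTop c) ≡ ∑ c
∑-padTop-count {zero}  c = refl
∑-padTop-count {suc k} c = cong (c F.zero +_) (∑-padTop-count (c ∘ F.suc))

padTop-HRep : ∀ {k} {a : Fin (suc k) → ℕ} {h y : ℕ} → HRep (a ∘ inject₁) h y → HRep a h y
padTop-HRep {a = a} (c , parts , value) =
    padTop c
  , subst (_≤ _) (sym (∑-padTop-count c)) parts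
  , trans (∑-padTop c a) value

inject₁<fromℕ : ∀ {k} (i : Fin k) → inject₁ i F.< fromℕ k
inject₁<fromℕ F.zero    = s≤s z≤n
inject₁<fromℕ (F.suc i) = s≤s (inject₁<fromℕ i)

shift-suc : ∀ {k} (a : Fin (suc k) → ℕ) (h0 y t : ℕ) → h0 ∸ 1 ≤ t →
  shift a h0 y (suc t) ≡ shift a h0 y t + top a
shift-suc a h0 y t lo =
  begin
    y + (suc t ∸ (h0 ∸ 1)) * top a    ≡⟨ cong (λ s → y + s * top a) (+-∸-assoc 1 lo) ⟩
    y + (top a + (t ∸ (h0 ∸ 1)) * top a) ≡⟨ cong (y +_) (+-comm (top a) _) ⟩
    y + ((t ∸ (h0 ∸ 1)) * top a + top a) ≡⟨ +-assoc y _ (top a) ⟨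
    shift a h0 y t + top a
  ∎

shift-exchange : ∀ {k} (a : Fin (suc k) → ℕ) (h0 x b : ℕ) → b ≤ top a → ∀ t → h0 ∸ 1 ≤ t →
  shift a h0 (x + (top a ∸ b)) t + b ≡ shift a h0 x (suc t)
shift-exchange a h0 x b b≤top t lo =
  begin
    (x + (top a ∸ b)) + T + b    ≡⟨ cong (_+ b) (+-assoc x _ T) ⟩
    x + ((top a ∸ b) + T) + b    ≡⟨ cong (λ s → x + s + b) (+-comm (top a ∸ b) T) ⟩
    x + (T + (top a ∸ b)) + b    ≡⟨ cong (λ s → s + b) (+-assoc x T _) ⟨
    x + T + (top a ∸ b) + b      ≡⟨ +-assoc (x + T) _ b ⟩
    x + T + ((top a ∸ b) + b)    ≡⟨ cong (x + T +_) (m∸n+n≡m b≤top) ⟩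
    shift a h0 x t + top a       ≡⟨ shift-suc a h0 x t lo ⟨
    shift a h0 x (suc t)
  ∎
  where T = (t ∸ (h0 ∸ 1)) * top a

theorem5 : (k : ℕ) (a : Fin (suc k) → ℕ) →
    a F.zero ≡ 1 →
    (∀ i j → i F.< j → a i < a j) →
    (h0 : ℕ) → IsH0 a h0 →
    (h : ℕ) → suc h0 ≤ h →
    (x : ℕ) → IsGap a h0 h x →
    (c : Fin k → ℕ) → ∑ c ≤ h →
    shift a h0 x h ≡ ∑ (λ i → c i * a (inject₁ i)) →
    ∀ i → 0 < c i → IsGap a h0 (h ∸ 1) (x + (top a ∸ a (inject₁ i)))
theorem5 k a _ increasing h0 _ (suc h) (s≤s h0≤h) x (_ , aboveRange , noRep , _)
         c parts value i ci>0 =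
  h0≤h , aboveRange′ , noRep′ , rep′
  where
  x′ = x + (top a ∸ a (inject₁ i))

  exchange : ∀ t → h0 ∸ 1 ≤ t → shift a h0 x′ t + a (inject₁ i) ≡ shift a h0 x (suc t)
  exchange = shift-exchange a h0 x _ (<⇒≤ (increasing (inject₁ i) (fromℕ k) (inject₁<fromℕ i)))

  aboveRange′ : ∀ N → IsRange a (h0 ∸ 1) N → N < x′
  aboveRange′ N range = ≤-trans (aboveRange N range) (m≤m+n x _)

  noRep′ : ∀ t → h0 ∸ 1 ≤ t → t < h → ¬ HRep a t (shift a h0 x′ t)
  noRep′ t lo hi rep = noRep (suc t) (m≤n⇒m≤1+n lo) (s≤s hi)
    (subst (HRep a (suc t)) (exchange t lo) (addPart {b = a} rep (inject₁ i)))

  rep′ : HRep a h (shift a h0 x′ h)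
  rep′ = padTop-HRep {a = a} (removePart {b = a ∘ inject₁} c i parts
           (trans (sym value) (sym (exchange h (≤-trans (m∸n≤m h0 1) h0≤h)))) ci>0)
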